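{- For every positive integer $\Delta$, \[ \chi'(3,\Delta) \ge 3 \left\lfloor \tfrac{\Delta}{2} \right\rfloor. \]
   Context: All graphs are finite, simple and loopless. A (proper) edge-coloring of a graph is a coloring of its edges such that any two edges sharing an endpoint receive distinct colors. The union of graphs $G_1,\ldots,G_\ell$ on the same vertex set $V$ is the simple graph $G$ on $V$ in which $uv$ is an edge iff $uv$ is an edge of at least one $G_i$. An edge-coloring of $G$ is simultaneous with respect to $G_1,\ldots,G_\ell$ if its restriction to the edge set of each $G_i$ is a proper edge-coloring of $G_i$. $\chi'(G_1,\ldots,G_\ell)$ denotes the minimum number of colors of a simultaneous edge-coloring of their union, and $\chi'(\ell,\Delta)$ denotes the largest integer $k$ such that $k=\chi'(G_1,\ldots,G_\ell)$ for some graphs $G_1,\ldots,G_\ell$ on a common vertex set, each of maximum degree at most $\Delta$. -}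

module Defs where

open import Data.Nat using (ℕ; zero; suc; _+_; _≤_)
open import Data.Fin using (Fin; zero; suc)
open import Data.Bool using (Bool; true; false; _∨_)
open import Data.Product using (Σ; ∃; _×_)
open import Relation.Binary.PropositionalEquality using (_≡_; _≢_)

count : ∀ {n} → (Fin n → Bool) → ℕ
count {zero}  p = 0
count {suc n} p with p zero
... | true  = suc (count (λ i → p (suc i)))
... | false = count (λ i → p (suc i))

record Graph (n : ℕ) : Set where
  field
    adj   : Fin n → Fin n → Bool
    sym   : ∀ u v → adj u v ≡ adj v u
    loopless : ∀ v → adj v v ≡ false
open Graph public

degree : ∀ {n} → Graph n → Fin n → ℕ
degree G v = count (adj G v)

MaxDegreeAtMost : ∀ {n} → ℕ → Graph n → Set
MaxDegreeAtMost Δ G = ∀ v → degree G v ≤ Δ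

unionAdj : ∀ {ℓ n} → (Fin ℓ → Graph n) → Fin n → Fin n → Bool
unionAdj {zero}  Gs u v = false
unionAdj {suc ℓ} Gs u v = adj (Gs zero) u v ∨ unionAdj (λ i → Gs (suc i)) u v

-- An edge-coloring of the union with colors from Fin k: a colour c u v for every
-- ordered pair, which is well defined on (unordered) edges of the union.
record EdgeColoring {ℓ n} (Gs : Fin ℓ → Graph n) (k : ℕ) : Set where
  field
    col : Fin n → Fin n → Fin k
    col-sym : ∀ u v → unionAdj Gs u v ≡ true → col u v ≡ col v u
open EdgeColoring public

IsSimultaneous : ∀ {ℓ n k} (Gs : Fin ℓ → Graph n) → EdgeColoring Gs k → Set
IsSimultaneous {ℓ} {n} Gs c =
  ∀ (i : Fin ℓ) (u v w : Fin n) →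
    adj (Gs i) u v ≡ true → adj (Gs i) u w ≡ true → v ≢ w →
    col c u v ≢ col c u w

-- χ'(G₁,…,G_ℓ) ≥ m : every simultaneous edge-coloring uses at least m colours
-- (colourings with k colours exist for k large, so the minimum exists)
SimChromaticIndexAtLeast : ∀ {ℓ n} → (Fin ℓ → Graph n) → ℕ → Set
SimChromaticIndexAtLeast {ℓ} {n} Gs m =
  ∀ (k : ℕ) (c : EdgeColoring Gs k) → IsSimultaneous Gs c → m ≤ k

-- χ'(ℓ,Δ) ≥ m : since χ'(ℓ,Δ) is the largest value of χ'(G₁,…,G_ℓ) over graphs on a
-- common vertex set with maximum degree ≤ Δ, this means some such family attains ≥ m.
SimChromaticIndexBoundAtLeast : ℕ → ℕ → ℕ → Set
SimChromaticIndexBoundAtLeast ℓ Δ m =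
  Σ ℕ λ n → Σ (Fin ℓ → Graph n) λ Gs →
    (∀ i → MaxDegreeAtMost Δ (Gs i)) × SimChromaticIndexAtLeast Gs m

module Submission where

-- Let d = ⌊Δ/2⌋.  Take a star with centre 0 and 3d leaves, split into three
-- blocks of d leaves each, and let G_i be the sub-star on the two blocks other
-- than block i.  Every G_i has centre degree 2d ≤ Δ and leaf degrees ≤ 1.  Any
-- two leaves lie in a common G_i (three blocks, each G_i misses only one), so
-- in a simultaneous colouring the 3d edges at the centre pairwise receive
-- distinct colours; hence at least 3d colours are needed.

open import Defs
open import Data.Nat using (ℕ; _≤_; _*_; _/_; zero; suc; _+_; z≤n; s≤s)
open import Data.Nat.Properties using (≤-trans; ≤-reflexive; *-comm)
open import Data.Nat.DivMod using (m/n*n≤m)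
open import Data.Fin using (Fin; zero; suc; _↑ˡ_; _↑ʳ_; combine; quotient)
open import Data.Fin.Properties using (suc-injective; injective⇒≤; remQuot-combine) renaming (_≟_ to _≟ᶠ_)
open import Data.Bool using (Bool; true; false; not)
open import Data.Product using (Σ; _×_; _,_; proj₁)
open import Relation.Binary.PropositionalEquality using (_≡_; refl; cong; cong₂; module ≡-Reasoning)
open import Relation.Nullary using (yes; no; does)
open import Data.Empty using (⊥-elim)

count-ext : ∀ {n} (p q : Fin n → Bool) → (∀ i → p i ≡ q i) → count p ≡ count q
count-ext {zero}  p q h = refl
count-ext {suc n} p q h with p zero | q zero | h zero
... | true  | true  | _ = cong suc (count-ext _ _ (λ i → h (suc i)))
... | false | false | _ = count-ext _ _ (λ i → h (suc i))

count-true : ∀ n → count {n} (λ _ → true) ≡ n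
count-true zero    = refl
count-true (suc n) = cong suc (count-true n)

count-false : ∀ n → count {n} (λ _ → false) ≡ 0
count-false zero    = refl
count-false (suc n) = count-false n

count-++ : ∀ a b (p : Fin (a + b) → Bool) →
  count p ≡ count (λ i → p (i ↑ˡ b)) + count (λ i → p (a ↑ʳ i))
count-++ zero    b p = refl
count-++ (suc a) b p with p zero
... | true  = cong suc (count-++ a b (λ i → p (suc i)))
... | false = count-++ a b (λ i → p (suc i))

count-head-block : ∀ {m} d (p : Fin (suc m) → Bool) →
  count {d} (λ _ → p zero) + count (λ i → p (suc i)) * d ≡ count p * d
count-head-block d p with p zero
... | true  = cong (_+ count (λ i → p (suc i)) * d) (count-true d)
... | false = cong (_+ count (λ i → p (suc i)) * d) (count-false d)

count-blocks : ∀ m d (p : Fin m → Bool) (q : Fin (m * d) → Bool) →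
  (∀ i j → q (combine i j) ≡ p i) → count q ≡ count p * d
count-blocks zero    d p q onBlock = refl
count-blocks (suc m) d p q onBlock = begin
    count q
  ≡⟨ count-++ d (m * d) q ⟩
    count (λ j → q (j ↑ˡ (m * d))) + count (λ x → q (d ↑ʳ x))
  ≡⟨ cong₂ _+_ (count-ext _ _ (onBlock zero))
               (count-blocks m d (λ i → p (suc i)) _ (λ i → onBlock (suc i))) ⟩
    count {d} (λ _ → p zero) + count (λ i → p (suc i)) * d
  ≡⟨ count-head-block d p ⟩
    count p * d
  ∎
  where open ≡-Reasoning

starAdj : ∀ {m} → (Fin m → Bool) → Fin (suc m) → Fin (suc m) → Bool
starAdj L zero    zero    = false
starAdj L zero    (suc j) = L j
starAdj L (suc j) zero    = L j
starAdj L (suc j) (suc k) = false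

star : ∀ {m} → (Fin m → Bool) → Graph (suc m)
star L = record { adj = starAdj L ; sym = symmetric ; loopless = loopless′ }
  where
  symmetric : ∀ u v → starAdj L u v ≡ starAdj L v u
  symmetric zero    zero    = refl
  symmetric zero    (suc j) = refl
  symmetric (suc j) zero    = refl
  symmetric (suc j) (suc k) = refl

  loopless′ : ∀ v → starAdj L v v ≡ false
  loopless′ zero    = refl
  loopless′ (suc v) = refl

star-leaf-degree : ∀ {m} (L : Fin m → Bool) j → degree (star L) (suc j) ≤ 1
star-leaf-degree {m} L j with L j
... | true  = s≤s (≤-reflexive (count-false m))
... | false = ≤-trans (≤-reflexive (count-false m)) z≤n

star-max-degree : ∀ {m Δ} (L : Fin m → Bool) → 1 ≤ Δ → count L ≤ Δ →
  MaxDegreeAtMost Δ (star L)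
star-max-degree L 1≤Δ centre≤Δ zero    = centre≤Δ
star-max-degree L 1≤Δ centre≤Δ (suc j) = ≤-trans (star-leaf-degree L j) 1≤Δ

-- Stars L₁,…,L_ℓ on a common centre in which every two leaves lie in a common
-- star: the m centre edges pairwise meet in some G_i, so they need m colours.
stars-need-all-colours : ∀ {ℓ m} (L : Fin ℓ → Fin m → Bool) →
  (∀ x y → Σ (Fin ℓ) λ i → L i x ≡ true × L i y ≡ true) →
  SimChromaticIndexAtLeast (λ i → star (L i)) m
stars-need-all-colours {m = m} L shared k c simultaneous = injective⇒≤ centreColour-injective
  where
  centreColour : Fin m → Fin k
  centreColour j = col c zero (suc j)

  centreColour-injective : ∀ {x y} → centreColour x ≡ centreColour y → x ≡ y
  centreColour-injective {x} {y} sameColour with x ≟ᶠ y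
  ... | yes x≡y = x≡y
  ... | no  x≢y with shared x y
  ...   | i , x∈Lᵢ , y∈Lᵢ = ⊥-elim
            (simultaneous i zero (suc x) (suc y) x∈Lᵢ y∈Lᵢ (λ e → x≢y (suc-injective e)) sameColour)

-- Graph i contains the leaves of every block except block i.
covers : Fin 3 → Fin 3 → Bool
covers i b = not (does (i ≟ᶠ b))

covers-two-blocks : ∀ i → count (covers i) ≡ 2
covers-two-blocks zero             = refl
covers-two-blocks (suc zero)       = refl
covers-two-blocks (suc (suc zero)) = refl

-- Any two blocks are covered by a common graph: one avoiding both.
common-cover : ∀ a b → Σ (Fin 3) λ i → covers i a ≡ true × covers i b ≡ true
common-cover zero             zero             = suc zero , refl , refl
common-cover zero             (suc zero)       = suc (suc zero) , refl , refl
common-cover zero             (suc (suc zero)) = suc zero , refl , refl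
common-cover (suc zero)       zero             = suc (suc zero) , refl , refl
common-cover (suc zero)       (suc zero)       = zero , refl , refl
common-cover (suc zero)       (suc (suc zero)) = zero , refl , refl
common-cover (suc (suc zero)) zero             = suc zero , refl , refl
common-cover (suc (suc zero)) (suc zero)       = zero , refl , refl
common-cover (suc (suc zero)) (suc (suc zero)) = zero , refl , refl

blockLeaves : ∀ d → Fin 3 → Fin (3 * d) → Bool
blockLeaves d i j = covers i (quotient d j)

blockLeaves-count : ∀ d i → count (blockLeaves d i) ≡ 2 * d
blockLeaves-count d i = begin
    count (blockLeaves d i)
  ≡⟨ count-blocks 3 d (covers i) _ (λ b j → cong (λ bj → covers i (proj₁ bj)) (remQuot-combine b j)) ⟩
    count (covers i) * d
  ≡⟨ cong (_* d) (covers-two-blocks i) ⟩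
    2 * d
  ∎
  where open ≡-Reasoning

mainTheorem3 : (Δ : ℕ) → 1 ≤ Δ → SimChromaticIndexBoundAtLeast 3 Δ (3 * (Δ / 2))
mainTheorem3 Δ 1≤Δ = suc (3 * d) , Gs , maxDegree , needColours
  where
  d : ℕ
  d = Δ / 2

  Gs : Fin 3 → Graph (suc (3 * d))
  Gs i = star (blockLeaves d i)

  twoBlocks≤Δ : 2 * d ≤ Δ
  twoBlocks≤Δ = ≤-trans (≤-reflexive (*-comm 2 d)) (m/n*n≤m Δ 2)

  maxDegree : ∀ i → MaxDegreeAtMost Δ (Gs i)
  maxDegree i = star-max-degree (blockLeaves d i) 1≤Δ
    (≤-trans (≤-reflexive (blockLeaves-count d i)) twoBlocks≤Δ)

  needColours : SimChromaticIndexAtLeast Gs (3 * d)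
  needColours = stars-need-all-colours (blockLeaves d)
    (λ x y → common-cover (quotient d x) (quotient d y))
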